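{- Let $G=(V,E)$ be an atomic bispanning graph, $v\in V$ a vertex of degree $3$ with incident edges $e_x,e_y,e_z$, and $(S,T)$ a pair of disjoint spanning trees of $G$ with $S\cup T=E$. Let $e_c$ be the one of $e_x,e_y,e_z$ lying alone in its tree (the other two, $e_a,e_b$, lie in the other tree), and let $e_a$ be the one of those two contained in the fundamental cycle closed by $e_c$ in the other tree. Then $(e_c,e_a,S,T)$ is an arc of $\vec{\tau}_3(G)$, i.e. if $e_c\in S$ then $D_G(S,e_c)\cap C_G(T,e_c)=\{e_c,e_a\}$, and if $e_c\in T$ then $D_G(T,e_c)\cap C_G(S,e_c)=\{e_c,e_a\}$.
   Context: Graphs are finite, undirected, may have parallel edges, no loops; bispanning means the edge set is the disjoint union of two spanning trees; atomic means no subgraph other than $G$ and $K_1$ is bispanning. For a spanning tree $T$ and $e\notin T$, $C_G(T,e)$ is the unique cycle in $T+e$; for a spanning tree $S$ and $e\in S$, $D_G(S,e)$ is the set of edges joining the two components of $S-e$. $\vec{\tau}_3(G)$ is the directed graph on ordered pairs of disjoint spanning trees covering $E$, with arcs $(e,f,S,T)$ exactly for $(e,f)\in S\times T$ with $D_G(S,e)\cap C_G(T,e)=\{e,f\}$ (to $(S-e+f,T+e-f)$) and for $(e,f)\in T\times S$ with $D_G(T,e)\cap C_G(S,e)=\{e,f\}$ (to $(S+e-f,T-e+f)$). -}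

module Defs where

open import Data.Nat using (ℕ)
open import Data.Fin using (Fin)
open import Data.Fin.Subset using (Subset; _∈_; _∉_; _∩_; _∪_; _-_; ⊤; ⁅_⁆; ∣_∣; Nonempty; Empty)
open import Data.Product using (Σ; ∃; ∃-syntax; _×_; _,_; proj₁; proj₂)
open import Data.Sum using (_⊎_)
open import Data.List using (List; []; _∷_)
open import Data.List.Relation.Unary.Unique.Propositional using (Unique)
import Data.List.Membership.Propositional as LM
open import Relation.Binary.PropositionalEquality using (_≡_; _≢_)
open import Relation.Nullary using (¬_)

record Graph : Set where
  field
    n : ℕ
    m : ℕ
    ends : Fin m → Fin n × Fin n
    loopless : ∀ e → proj₁ (ends e) ≢ proj₂ (ends e)

module _ (G : Graph) where
  open Graph G

  Vertex : Set
  Vertex = Fin n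

  Edge : Set
  Edge = Fin m

  Joins : Edge → Vertex → Vertex → Set
  Joins e u w = (ends e ≡ (u , w)) ⊎ (ends e ≡ (w , u))

  Incident : Edge → Vertex → Set
  Incident e v = (proj₁ (ends e) ≡ v) ⊎ (proj₂ (ends e) ≡ v)

  data Walk (A : Subset m) : Vertex → Vertex → List Edge → List Vertex → Set where
    nil  : ∀ {u} → Walk A u u [] (u ∷ [])
    cons : ∀ {u w x es vs} (e : Edge) → e ∈ A → Joins e u w →
           Walk A w x es vs → Walk A u x (e ∷ es) (u ∷ vs)

  Reach : Subset m → Vertex → Vertex → Set
  Reach A u w = ∃[ es ] ∃[ vs ] Walk A u w es vs

  Path : Subset m → Vertex → Vertex → List Edge → Set
  Path A u w es = ∃[ vs ] (Walk A u w es vs × Unique vs)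

  CycleThrough : Subset m → Edge → Set
  CycleThrough F e = e ∈ F × ∃[ es ] Path (F - e) (proj₂ (ends e)) (proj₁ (ends e)) es

  Acyclic : Subset m → Set
  Acyclic F = ∀ e → ¬ CycleThrough F e

  -- F is a spanning tree of the (sub)graph with vertex set W and edge set F
  -- (F is assumed to have all endpoints in W).
  SpanningTreeOn : Subset n → Subset m → Set
  SpanningTreeOn W F = (∀ u w → u ∈ W → w ∈ W → Reach F u w) × Acyclic F

  SpanningTree : Subset m → Set
  SpanningTree S = SpanningTreeOn ⊤ S

  IsSubgraph : Subset n → Subset m → Set
  IsSubgraph W F = Nonempty W ×
    (∀ e → e ∈ F → proj₁ (ends e) ∈ W × proj₂ (ends e) ∈ W)

  BispanningOn : Subset n → Subset m → Set
  BispanningOn W F = ∃[ F₁ ] ∃[ F₂ ]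
    (Empty (F₁ ∩ F₂) × (F₁ ∪ F₂ ≡ F) × SpanningTreeOn W F₁ × SpanningTreeOn W F₂)

  Bispanning : Set
  Bispanning = BispanningOn ⊤ ⊤

  Atomic : Set
  Atomic = Bispanning ×
    (∀ W F → IsSubgraph W F → BispanningOn W F →
       ((W ≡ ⊤) × (F ≡ ⊤)) ⊎ (∣ W ∣ ≡ 1))

  -- f ∈ C_G(T, e): e together with the T-path joining the endpoints of e,
  -- i.e. the unique cycle of T + e (for e ∉ T).
  InFundCycle : Subset m → Edge → Edge → Set
  InFundCycle T e f = (f ≡ e) ⊎
    (∃[ es ] (Path T (proj₂ (ends e)) (proj₁ (ends e)) es × LM._∈_ f es))

  -- f ∈ D_G(S, e): f joins the component of S - e containing one end of e
  -- to the component containing the other end.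
  InFundCut : Subset m → Edge → Edge → Set
  InFundCut S e f =
    (Reach (S - e) (proj₁ (ends e)) (proj₁ (ends f)) × Reach (S - e) (proj₂ (ends e)) (proj₂ (ends f)))
    ⊎ (Reach (S - e) (proj₁ (ends e)) (proj₂ (ends f)) × Reach (S - e) (proj₂ (ends e)) (proj₁ (ends f)))

  CutCycleMeet : Subset m → Subset m → Edge → Edge → Set
  CutCycleMeet S T e f = ∀ g →
    ((InFundCut S e g × InFundCycle T e g) → ((g ≡ e) ⊎ (g ≡ f)))
    × (((g ≡ e) ⊎ (g ≡ f)) → (InFundCut S e g × InFundCycle T e g))

EdgeSet : Graph → Set
EdgeSet G = Subset (Graph.m G)

-- Since e_c is the only S-edge at v, the vertex v is isolated in S - e_c while the rest of
-- S - e_c stays connected (an S-walk through v enters and leaves by e_c, so it can be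
-- shortcut).  Hence D(S, e_c) is exactly the set {e_c, e_a, e_b} of edges at v.  The cycle
-- C(T, e_c) passes through v and, T being a forest, leaves v by a single T-edge: two
-- T-paths from v to the same vertex starting with e_a and e_b respectively would close a
-- cycle through e_b.  So C(T, e_c) contains e_a but not e_b.
module Submission where

open import Defs
open import Data.Fin using (Fin; _≟_)
open import Data.Fin.Subset using (Subset; _∈_; _∉_; _∩_; _∪_; _─_; _-_; ⊤; Empty; inside; outside)
open import Data.Fin.Subset.Properties using (x∈p∧x≢y⇒x∈p-y; p─q⊆p; x∈p∩q⁺; x∈⁅x⁆; ∈⊤; ∩-comm)
open import Data.Vec using (_∷_; here; there)
open import Data.Product using (_×_; _,_; proj₁; proj₂; swap; ∃-syntax)
open import Data.Product.Properties using (×-≡,≡←≡)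
open import Data.Sum using (_⊎_; inj₁; inj₂)
open import Data.Empty using (⊥-elim)
open import Data.List using (List; []; _∷_; reverse; _∷ʳ_)
open import Data.List.Properties using (unfold-reverse)
open import Data.List.Relation.Unary.Any using (here; there; any?)
open import Data.List.Relation.Unary.Any.Properties using (reverse⁺)
import Data.List.Membership.Propositional as List
open import Data.List.Relation.Unary.Unique.Propositional using (Unique)
open import Data.List.Relation.Unary.AllPairs using ([]; _∷_)
open import Data.List.Relation.Unary.All using (All; []; lookup)
open import Data.List.Relation.Unary.All.Properties using (¬Any⇒All¬)
open import Data.List.Relation.Binary.Permutation.Propositional using (↭-sym; ↭⇒↭ₛ)
open import Data.List.Relation.Binary.Permutation.Propositional.Properties using (↭-reverse)
open import Data.List.Relation.Binary.Permutation.Setoid.Properties using (Unique-resp-↭)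
open import Function using (_∘_)
open import Function.Bundles using (_⇔_; mk⇔; Equivalence)
open import Relation.Binary.PropositionalEquality
open import Relation.Nullary using (¬_; yes; no)

x∈p─q⇒x∉q : ∀ {k} {x : Fin k} (p q : Subset k) → x ∈ p ─ q → x ∉ q
x∈p─q⇒x∉q (inside ∷ p) (outside ∷ q) here ()
x∈p─q⇒x∉q (_ ∷ p) (_ ∷ q) (there x∈p─q) (there x∈q) = x∈p─q⇒x∉q p q x∈p─q x∈q

x∈p-y⇒x∈p : ∀ {k} {x y : Fin k} {p : Subset k} → x ∈ p - y → x ∈ p
x∈p-y⇒x∈p {p = p} = p─q⊆p p _

x∈p-y⇒x≢y : ∀ {k} {x y : Fin k} {p : Subset k} → x ∈ p - y → x ≢ y
x∈p-y⇒x≢y {y = y} {p} x∈p-y refl = x∈p─q⇒x∉q p _ x∈p-y (x∈⁅x⁆ y)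

unique-reverse : ∀ {a} {A : Set a} {xs : List A} → Unique xs → Unique (reverse xs)
unique-reverse {A = A} {xs} = Unique-resp-↭ (setoid A) (↭⇒↭ₛ (↭-sym (↭-reverse xs)))

module _ (G : Graph) where
  open Graph G

  Connected : EdgeSet G → Set
  Connected A = ∀ u w → Reach G A u w

  SoleEdgeAt : EdgeSet G → Vertex G → Edge G → Set
  SoleEdgeAt A v e = ∀ f → f ∈ A → Incident G f v → f ≡ e

  spanningTree⇒connected : ∀ {A} → SpanningTree G A → Connected A
  spanningTree⇒connected (spans , _) u w = spans u w ∈⊤ ∈⊤

  joins⇒incident : ∀ {e u w} → Joins G e u w → Incident G e u × Incident G e w
  joins⇒incident (inj₁ refl) = inj₁ refl , inj₂ refl
  joins⇒incident (inj₂ refl) = inj₂ refl , inj₁ refl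

  joins-sym : ∀ {e u w} → Joins G e u w → Joins G e w u
  joins-sym (inj₁ eq) = inj₂ eq
  joins-sym (inj₂ eq) = inj₁ eq

  joins-unique : ∀ {e a b c d} → Joins G e a b → Joins G e c d →
    (a ≡ c × b ≡ d) ⊎ (a ≡ d × b ≡ c)
  joins-unique (inj₁ refl) (inj₁ eq) = inj₁ (×-≡,≡←≡ eq)
  joins-unique (inj₁ refl) (inj₂ eq) = inj₂ (×-≡,≡←≡ eq)
  joins-unique (inj₂ refl) (inj₁ eq) = inj₂ (swap (×-≡,≡←≡ eq))
  joins-unique (inj₂ refl) (inj₂ eq) = inj₁ (swap (×-≡,≡←≡ eq))

  incident⇒joins : ∀ {e v} → Incident G e v → ∃[ w ] (Joins G e v w × w ≢ v)
  incident⇒joins {e} (inj₁ refl) = _ , inj₁ refl , loopless e ∘ sym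
  incident⇒joins {e} (inj₂ refl) = _ , inj₂ refl , loopless e

  reach-refl : ∀ {A u} → Reach G A u u
  reach-refl = _ , _ , nil

  reach-trans : ∀ {A u w x} → Reach G A u w → Reach G A w x → Reach G A u x
  reach-trans (_ , _ , nil) r = r
  reach-trans (_ , _ , cons e e∈A j W) r with reach-trans (_ , _ , W) r
  ... | _ , _ , W′ = _ , _ , cons e e∈A j W′

  reach-sym : ∀ {A u w} → Reach G A u w → Reach G A w u
  reach-sym (_ , _ , nil) = _ , _ , nil
  reach-sym (_ , _ , cons e e∈A j W) =
    reach-trans (reach-sym (_ , _ , W)) (_ , _ , cons e e∈A (joins-sym j) nil)

  walk-mono : ∀ {A B u w es vs} → Walk G A u w es vs →
    (∀ e → e ∈ A → e List.∈ es → e ∈ B) → Walk G B u w es vs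
  walk-mono nil _ = nil
  walk-mono (cons e e∈A j W) A⊆B =
    cons e (A⊆B e e∈A (here refl)) j (walk-mono W (λ f f∈A f∈es → A⊆B f f∈A (there f∈es)))

  walk-start∈ : ∀ {A u w es vs} → Walk G A u w es vs → u List.∈ vs
  walk-start∈ nil = here refl
  walk-start∈ (cons _ _ _ _) = here refl

  walk-ends∈ : ∀ {A u w es vs f} → Walk G A u w es vs → f List.∈ es →
    proj₁ (ends f) List.∈ vs × proj₂ (ends f) List.∈ vs
  walk-ends∈ (cons _ _ (inj₁ refl) W) (here refl) = here refl , there (walk-start∈ W)
  walk-ends∈ (cons _ _ (inj₂ refl) W) (here refl) = there (walk-start∈ W) , here refl
  walk-ends∈ (cons _ _ _ W) (there f∈es) with walk-ends∈ W f∈es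
  ... | p∈vs , q∈vs = there p∈vs , there q∈vs

  walk-avoids-incident : ∀ {A u w es vs v f} → Walk G A u w es vs → All (v ≢_) vs →
    f List.∈ es → ¬ Incident G f v
  walk-avoids-incident W v∉vs f∈es (inj₁ refl) = lookup v∉vs (proj₁ (walk-ends∈ W f∈es)) refl
  walk-avoids-incident W v∉vs f∈es (inj₂ refl) = lookup v∉vs (proj₂ (walk-ends∈ W f∈es)) refl

  walk-minus-incident : ∀ {A u w es vs v f} → Walk G A u w es vs → All (v ≢_) vs →
    Incident G f v → Walk G (A - f) u w es vs
  walk-minus-incident W v∉vs f∼v =
    walk-mono W λ e e∈A e∈es →
      x∈p∧x≢y⇒x∈p-y e∈A λ { refl → walk-avoids-incident W v∉vs e∈es f∼v }

  walk-suffix : ∀ {A u w x es vs} → Walk G A w x es vs → Unique vs → u List.∈ vs →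
    ∃[ es′ ] Path G A u x es′
  walk-suffix nil uq (here refl) = _ , _ , nil , uq
  walk-suffix W@(cons _ _ _ _) uq (here refl) = _ , _ , W , uq
  walk-suffix (cons _ _ _ W) (_ ∷ uq) (there u∈vs) = walk-suffix W uq u∈vs

  walk⇒path : ∀ {A u x es vs} → Walk G A u x es vs → ∃[ es′ ] Path G A u x es′
  walk⇒path nil = _ , _ , nil , [] ∷ []
  walk⇒path {u = u} (cons e e∈A j W) with walk⇒path W
  ... | _ , vs , P , uq with any? (u ≟_) vs
  ...   | yes u∈vs = walk-suffix P uq u∈vs
  ...   | no u∉vs = _ , _ , cons e e∈A j P , ¬Any⇒All¬ vs u∉vs ∷ uq

  reach⇒path : ∀ {A u x} → Reach G A u x → ∃[ es ] Path G A u x es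
  reach⇒path (_ , _ , W) = walk⇒path W

  walk-snoc : ∀ {A u w x es vs e} → Walk G A u w es vs → e ∈ A → Joins G e w x →
    Walk G A u x (es ∷ʳ e) (vs ∷ʳ x)
  walk-snoc nil e∈A j = cons _ e∈A j nil
  walk-snoc (cons f f∈A j′ W) e∈A j = cons f f∈A j′ (walk-snoc W e∈A j)

  walk-reverse : ∀ {A u w es vs} → Walk G A u w es vs →
    Walk G A w u (reverse es) (reverse vs)
  walk-reverse nil = nil
  walk-reverse {A} {u} {w} (cons {es = es} {vs = vs} e e∈A j W) =
    subst₂ (Walk G A w u) (sym (unfold-reverse e es)) (sym (unfold-reverse u vs))
      (walk-snoc (walk-reverse W) e∈A (joins-sym j))

  path-reverse : ∀ {A u w es} → Path G A u w es → Path G A w u (reverse es)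
  path-reverse (vs , W , uq) = reverse vs , walk-reverse W , unique-reverse uq

  reach⇒cycle : ∀ {A e u w} → e ∈ A → Joins G e u w → Reach G (A - e) u w →
    CycleThrough G A e
  reach⇒cycle e∈A (inj₁ refl) r = e∈A , reach⇒path (reach-sym r)
  reach⇒cycle e∈A (inj₂ refl) r = e∈A , reach⇒path r

  module _ {A v e} (sole : SoleEdgeAt A v e) where

    other-edge-not-at : ∀ {f y} → f ∈ A → f ≢ e → Incident G f y → y ≢ v
    other-edge-not-at f∈A f≢e f∼y refl = f≢e (sole _ f∈A f∼y)

    sole⇒isolated : ∀ {w} → Reach G (A - e) v w → v ≡ w
    sole⇒isolated (_ , _ , nil) = refl
    sole⇒isolated (_ , _ , cons f f∈A-e j _) =
      ⊥-elim (other-edge-not-at (x∈p-y⇒x∈p f∈A-e) (x∈p-y⇒x≢y f∈A-e)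
                                (proj₁ (joins⇒incident j)) refl)

    module _ {o} (J : Joins G e v o) (o≢v : o ≢ v) where

      -- A walk can only pass through v along e, so replacing the visit by o gives a detour.
      walk-bypass : ∀ {u x es vs} → Walk G A u x es vs → x ≢ v →
        (u ≢ v → Reach G (A - e) u x) × (u ≡ v → Reach G (A - e) o x)
      walk-bypass nil x≢v = (λ _ → reach-refl) , (λ u≡v → ⊥-elim (x≢v u≡v))
      walk-bypass (cons f f∈A j W) x≢v with walk-bypass W x≢v | f ≟ e
      ... | from-w , from-v | yes refl with joins-unique j J
      ...   | inj₁ (u≡v , w≡o) =
                (λ u≢v → ⊥-elim (u≢v u≡v)) ,
                (λ _ → subst (λ z → Reach G (A - e) z _) w≡o (from-w (o≢v ∘ trans (sym w≡o))))
      ...   | inj₂ (u≡o , w≡v) =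
                (λ _ → subst (λ z → Reach G (A - e) z _) (sym u≡o) (from-v w≡v)) ,
                (λ u≡v → ⊥-elim (o≢v (trans (sym u≡o) u≡v)))
      walk-bypass (cons f f∈A j W) x≢v | from-w , _ | no f≢e =
        (λ _ → reach-trans (_ , _ , cons f (x∈p∧x≢y⇒x∈p-y f∈A f≢e) j nil)
                            (from-w (other-edge-not-at f∈A f≢e (proj₂ (joins⇒incident j))))) ,
        (λ u≡v → ⊥-elim (other-edge-not-at f∈A f≢e (proj₁ (joins⇒incident j)) u≡v))

      connected-minus-sole : Connected A → ∀ {u w} → u ≢ v → w ≢ v →
        Reach G (A - e) u w
      connected-minus-sole conn {u} {w} u≢v w≢v with conn u w
      ... | _ , _ , W = proj₁ (walk-bypass W w≢v) u≢v

  fundCut⁺ : ∀ {A e g u w u′ w′} → Joins G e u w → Joins G g u′ w′ →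
    Reach G (A - e) u u′ → Reach G (A - e) w w′ → InFundCut G A e g
  fundCut⁺ (inj₁ refl) (inj₁ refl) r r′ = inj₁ (r , r′)
  fundCut⁺ (inj₁ refl) (inj₂ refl) r r′ = inj₂ (r , r′)
  fundCut⁺ (inj₂ refl) (inj₁ refl) r r′ = inj₂ (r′ , r)
  fundCut⁺ (inj₂ refl) (inj₂ refl) r r′ = inj₁ (r′ , r)

  fundCut⁻ : ∀ {A e g u w} → InFundCut G A e g → Joins G e u w →
    ∃[ u′ ] ∃[ w′ ] (Joins G g u′ w′ × Reach G (A - e) u u′ × Reach G (A - e) w w′)
  fundCut⁻ (inj₁ (r , r′)) (inj₁ refl) = _ , _ , inj₁ refl , r , r′
  fundCut⁻ (inj₂ (r , r′)) (inj₁ refl) = _ , _ , inj₂ refl , r , r′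
  fundCut⁻ (inj₁ (r , r′)) (inj₂ refl) = _ , _ , inj₂ refl , r′ , r
  fundCut⁻ (inj₂ (r , r′)) (inj₂ refl) = _ , _ , inj₁ refl , r′ , r

  fundCut-sole : ∀ {A v e} → Connected A → SoleEdgeAt A v e → Incident G e v →
    ∀ g → InFundCut G A e g ⇔ Incident G g v
  fundCut-sole {A} {v} {e} conn sole e∼v g with incident⇒joins e∼v
  ... | o , J , o≢v = mk⇔ cut⇒incident incident⇒cut
    where
    cut⇒incident : InFundCut G A e g → Incident G g v
    cut⇒incident g∈D with fundCut⁻ g∈D J
    ... | _ , _ , J′ , v⇝u′ , _ =
      subst (Incident G g) (sym (sole⇒isolated sole v⇝u′)) (proj₁ (joins⇒incident J′))

    incident⇒cut : Incident G g v → InFundCut G A e g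
    incident⇒cut g∼v with incident⇒joins g∼v
    ... | o′ , J′ , o′≢v =
      fundCut⁺ J J′ reach-refl (connected-minus-sole sole J o≢v conn o≢v o′≢v)

  incident-edge-is-first : ∀ {A x w e es vs v f} → All (v ≢_) vs →
    Walk G A x w es vs → f List.∈ (e ∷ es) → Incident G f v → f ≡ e
  incident-edge-is-first _ _ (here f≡e) _ = f≡e
  incident-edge-is-first v∉vs W (there f∈es) f∼v =
    ⊥-elim (walk-avoids-incident W v∉vs f∈es f∼v)

  -- Two tree paths leaving v by different edges e₁, e₂ would close the cycle e₁ W₁ W₂⁻¹ e₂.
  forest-path-first-edge-unique : ∀ {A v w es₁ es₂ f₁ f₂} → Acyclic G A →
    Path G A v w es₁ → Path G A v w es₂ → f₁ List.∈ es₁ → f₂ List.∈ es₂ →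
    Incident G f₁ v → Incident G f₂ v → f₁ ≡ f₂
  forest-path-first-edge-unique {A} {v} acyc
    (_ , cons e₁ e₁∈A j₁ W₁ , v∉vs₁ ∷ _) (_ , cons e₂ e₂∈A j₂ W₂ , v∉vs₂ ∷ _)
    f₁∈es₁ f₂∈es₂ f₁∼v f₂∼v
    with incident-edge-is-first v∉vs₁ W₁ f₁∈es₁ f₁∼v
       | incident-edge-is-first v∉vs₂ W₂ f₂∈es₂ f₂∼v
  ... | refl | refl with e₁ ≟ e₂
  ...   | yes e₁≡e₂ = e₁≡e₂
  ...   | no e₁≢e₂ = ⊥-elim (acyc e₂ (reach⇒cycle e₂∈A j₂ cycle-rest))
    where
    cycle-rest : Reach G (A - e₂) v _
    cycle-rest =
      reach-trans (_ , _ , cons e₁ (x∈p∧x≢y⇒x∈p-y e₁∈A e₁≢e₂) j₁ (walk-minus-incident W₁ v∉vs₁ f₂∼v))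
                  (reach-sym (_ , _ , walk-minus-incident W₂ v∉vs₂ f₂∼v))

  fundCycle-incident-unique : ∀ {A e v f₁ f₂} → Acyclic G A → Incident G e v →
    f₁ ≢ e → f₂ ≢ e → InFundCycle G A e f₁ → InFundCycle G A e f₂ →
    Incident G f₁ v → Incident G f₂ v → f₁ ≡ f₂
  fundCycle-incident-unique _ _ f₁≢e _ (inj₁ f₁≡e) _ _ _ = ⊥-elim (f₁≢e f₁≡e)
  fundCycle-incident-unique _ _ _ f₂≢e _ (inj₁ f₂≡e) _ _ = ⊥-elim (f₂≢e f₂≡e)
  fundCycle-incident-unique acyc (inj₁ refl) _ _ (inj₂ (_ , P₁ , f₁∈P₁)) (inj₂ (_ , P₂ , f₂∈P₂)) =
    forest-path-first-edge-unique acyc (path-reverse P₁) (path-reverse P₂)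
                                  (reverse⁺ f₁∈P₁) (reverse⁺ f₂∈P₂)
  fundCycle-incident-unique acyc (inj₂ refl) _ _ (inj₂ (_ , P₁ , f₁∈P₁)) (inj₂ (_ , P₂ , f₂∈P₂)) =
    forest-path-first-edge-unique acyc P₁ P₂ f₁∈P₁ f₂∈P₂

  cutCycleMeet-at-degree-three : ∀ {S T v ec ea eb} →
    Connected S → Acyclic G T → Empty (S ∩ T) →
    ec ≢ ea → ec ≢ eb → ea ≢ eb →
    Incident G ec v → Incident G ea v → Incident G eb v →
    (∀ e → Incident G e v → (e ≡ ec) ⊎ ((e ≡ ea) ⊎ (e ≡ eb))) →
    ea ∈ T → eb ∈ T → InFundCycle G T ec ea → CutCycleMeet G S T ec ea
  cutCycleMeet-at-degree-three {S} {T} {v} {ec} {ea} S-connected T-acyclic S∩T≡∅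
    ec≢ea ec≢eb ea≢eb ec∼v ea∼v eb∼v degree-three ea∈T eb∈T ea∈C g = meet⇒ , meet⇐
    where
    ∉S : ∀ {f} → f ∈ T → f ∉ S
    ∉S f∈T f∈S = S∩T≡∅ (_ , x∈p∩q⁺ (f∈S , f∈T))

    sole : SoleEdgeAt S v ec
    sole f f∈S f∼v with degree-three f f∼v
    ... | inj₁ f≡ec = f≡ec
    ... | inj₂ (inj₁ refl) = ⊥-elim (∉S ea∈T f∈S)
    ... | inj₂ (inj₂ refl) = ⊥-elim (∉S eb∈T f∈S)

    D-at-v : ∀ g → InFundCut G S ec g ⇔ Incident G g v
    D-at-v = fundCut-sole S-connected sole ec∼v

    meet⇒ : InFundCut G S ec g × InFundCycle G T ec g → (g ≡ ec) ⊎ (g ≡ ea)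
    meet⇒ (g∈D , g∈C) with degree-three g (Equivalence.to (D-at-v g) g∈D)
    ... | inj₁ g≡ec = inj₁ g≡ec
    ... | inj₂ (inj₁ g≡ea) = inj₂ g≡ea
    ... | inj₂ (inj₂ refl) =
      ⊥-elim (ea≢eb (fundCycle-incident-unique T-acyclic ec∼v (ec≢ea ∘ sym) (ec≢eb ∘ sym)
                                               ea∈C g∈C ea∼v eb∼v))

    meet⇐ : (g ≡ ec) ⊎ (g ≡ ea) → InFundCut G S ec g × InFundCycle G T ec g
    meet⇐ (inj₁ refl) = Equivalence.from (D-at-v ec) ec∼v , inj₁ refl
    meet⇐ (inj₂ refl) = Equivalence.from (D-at-v ea) ea∼v , ea∈C

mainTheorem19 : (G : Graph) → Atomic G →
    (v : Vertex G) (ec ea eb : Edge G) →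
    ec ≢ ea → ec ≢ eb → ea ≢ eb →
    Incident G ec v → Incident G ea v → Incident G eb v →
    (∀ e → Incident G e v → (e ≡ ec) ⊎ ((e ≡ ea) ⊎ (e ≡ eb))) →
    (S T : EdgeSet G) →
    SpanningTree G S → SpanningTree G T → Empty (S ∩ T) → S ∪ T ≡ ⊤ →
    ((ec ∈ S × ea ∈ T × eb ∈ T × InFundCycle G T ec ea) → CutCycleMeet G S T ec ea)
    × ((ec ∈ T × ea ∈ S × eb ∈ S × InFundCycle G S ec ea) → CutCycleMeet G T S ec ea)
mainTheorem19 G _ _ ec ea eb ec≢ea ec≢eb ea≢eb ec∼v ea∼v eb∼v degree-three
              S T S-tree T-tree S∩T≡∅ _ =
  (λ (_ , ea∈T , eb∈T , ea∈C) →
     cutCycleMeet-at-degree-three G (spanningTree⇒connected G S-tree) (proj₂ T-tree) S∩T≡∅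
       ec≢ea ec≢eb ea≢eb ec∼v ea∼v eb∼v degree-three ea∈T eb∈T ea∈C) ,
  (λ (_ , ea∈S , eb∈S , ea∈C) →
     cutCycleMeet-at-degree-three G (spanningTree⇒connected G T-tree) (proj₂ S-tree)
       (subst Empty (∩-comm S T) S∩T≡∅)
       ec≢ea ec≢eb ea≢eb ec∼v ea∼v eb∼v degree-three ea∈S eb∈S ea∈C)
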